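{- Let $G$ be a connected graph on $n$ vertices with largest adjacency eigenvalue $\lambda_1$, and let $\nu\in\mathbb{R}^{V(G)}$ be its Perron eigenvector, scaled so that $\|\nu\|=1$. Then there exists a vertex $u\in V(G)$ such that $$\sum_{v\in N(u)}\nu_v^2\ \ge\ \frac{\lambda_1}{n},$$ where $N(u)$ is the set of neighbours of $u$.
   Context: Graphs are finite and simple. The Perron eigenvector of a connected graph is the (unique up to scaling) eigenvector of the adjacency matrix, for the largest eigenvalue $\lambda_1$, all of whose entries are positive. -}

module Defs where

open import Level using (Level; _⊔_)
open import Data.Nat using (ℕ; zero; suc)
open import Data.Fin using (Fin; zero; suc)
open import Data.Bool using (Bool; true; false; if_then_else_)
open import Data.Product using (Σ; ∃; _×_; _,_)
open import Relation.Binary.PropositionalEquality using (_≡_)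
open import Relation.Binary.Structures using (IsTotalOrder)
open import Relation.Nullary using (¬_)
open import Algebra.Bundles using (CommutativeRing)

-- An ordered field (the real numbers ℝ are the intended model; stdlib has no ℝ).
record OrderedField (c ℓ : Level) : Set (Level.suc (c ⊔ ℓ)) where
  field
    commutativeRing : CommutativeRing c ℓ
  open CommutativeRing commutativeRing public
    using (Carrier; _≈_; _+_; _*_; -_; 0#; 1#)
  field
    _≤_          : Carrier → Carrier → Set ℓ
    isTotalOrder : IsTotalOrder _≈_ _≤_
    +-mono-≤     : ∀ {x y} z → x ≤ y → (x + z) ≤ (y + z)
    *-nonneg     : ∀ {x y} → 0# ≤ x → 0# ≤ y → 0# ≤ (x * y)
    0≉1          : ¬ (0# ≈ 1#)
    inverse      : ∀ x → ¬ (x ≈ 0#) → Σ Carrier (λ y → (x * y) ≈ 1#)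

  _<_ : Carrier → Carrier → Set ℓ
  x < y = (x ≤ y) × ¬ (x ≈ y)

  ∑ : ∀ {n} → (Fin n → Carrier) → Carrier
  ∑ {zero}  f = 0#
  ∑ {suc n} f = f zero + ∑ (λ i → f (suc i))

  fromℕ : ℕ → Carrier
  fromℕ zero    = 0#
  fromℕ (suc k) = 1# + fromℕ k

record Graph (n : ℕ) : Set where
  field
    adj     : Fin n → Fin n → Bool
    adj-sym : ∀ u v → adj u v ≡ adj v u
    irrefl  : ∀ u → adj u u ≡ false

module _ {n : ℕ} (G : Graph n) where
  open Graph G

  data Walk : Fin n → Fin n → Set where
    here : ∀ {u} → Walk u u
    step : ∀ {u w v} → adj u w ≡ true → Walk w v → Walk u v

  Connected : Set
  Connected = ∀ u v → Walk u v

module _ {c ℓ : Level} (F : OrderedField c ℓ) {n : ℕ} (G : Graph n) where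
  open OrderedField F
  open Graph G

  A : Fin n → Fin n → Carrier
  A u v = if adj u v then 1# else 0#

  Amul : (Fin n → Carrier) → Fin n → Carrier
  Amul x u = ∑ (λ v → A u v * x v)

  IsEigenpair : Carrier → (Fin n → Carrier) → Set ℓ
  IsEigenpair μ x = (Σ (Fin n) (λ i → ¬ (x i ≈ 0#))) × (∀ u → Amul x u ≈ (μ * x u))

  IsEigenvalue : Carrier → Set (c ⊔ ℓ)
  IsEigenvalue μ = Σ (Fin n → Carrier) (λ x → IsEigenpair μ x)

  IsLargestEigenvalue : Carrier → Set (c ⊔ ℓ)
  IsLargestEigenvalue λ₁ = IsEigenvalue λ₁ × (∀ μ → IsEigenvalue μ → μ ≤ λ₁)

  IsPerronEigenvector : Carrier → (Fin n → Carrier) → Set ℓ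
  IsPerronEigenvector λ₁ ν = IsEigenpair λ₁ ν × (∀ u → 0# < ν u)

  normSq : (Fin n → Carrier) → Carrier
  normSq ν = ∑ (λ v → ν v * ν v)

  nbrSqSum : (Fin n → Carrier) → Fin n → Carrier
  nbrSqSum ν u = ∑ (λ v → if adj u v then ν v * ν v else 0#)

{-# OPTIONS --safe #-}
-- λ₁ = νᵀAν = Σ_{u,v} A_uv ν_u ν_v, and 2 ν_u ν_v ≤ ν_u² + ν_v² together with the symmetry of A
-- gives νᵀAν ≤ Σ_u Σ_v A_uv ν_v² = Σ_u Σ_{v ∈ N(u)} ν_v²; the largest of these n inner sums is
-- at least their average.
module Submission where

open import Defs
open import Level using (Level)
open import Data.Nat using (ℕ; zero; suc)
open import Data.Fin using (Fin; zero; suc)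
open import Data.Product using (Σ; _,_)
open import Data.Bool using (true; false; if_then_else_)
open import Data.Sum using (inj₁; inj₂)
open import Data.Empty using (⊥-elim)
open import Relation.Binary.PropositionalEquality as ≡ using (_≡_; cong)
open import Relation.Binary.Bundles using (Poset)
open import Relation.Binary.Structures using (IsTotalOrder)
open import Algebra.Bundles using (CommutativeRing)
import Algebra.Properties.Group as GroupProperties
import Algebra.Properties.Ring as RingProperties
import Algebra.Properties.Semiring.Sum as SemiringSum
import Algebra.Properties.Semiring.Mult as SemiringMult
import Algebra.Solver.Ring.NaturalCoefficients.Default as NaturalSolver
import Relation.Binary.Reasoning.PartialOrder as PosetReasoning

module OrderedFieldProperties {c ℓ : Level} (F : OrderedField c ℓ) where
  open OrderedField F hiding (_≤_)
  open CommutativeRing commutativeRing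
    using ( refl; trans; +-cong; +-congˡ; *-congˡ; +-identityˡ; +-identityʳ; *-identityˡ; zeroʳ
          ; +-comm; -‿cong; -‿inverseˡ; -‿inverseʳ; ring; commutativeSemiring; +-group )
  open IsTotalOrder isTotalOrder public using (total; antisym)
    renaming (reflexive to ≤-reflexive; trans to ≤-trans)
  open RingProperties ring using (-‿distribˡ-*; -‿distribʳ-*; -‿involutive)
  open GroupProperties +-group using () renaming (∙-cancelʳ to +-cancelʳ)
  open NaturalSolver commutativeSemiring using (solve; _:+_; _:*_; _:=_)

  -- Defs declares no fixity for _≤_; this copy binds looser than _+_ and _*_.
  infix 4 _≤_
  _≤_ : Carrier → Carrier → Set ℓ
  _≤_ = OrderedField._≤_ F

  poset : Poset c ℓ ℓ
  poset = record { isPartialOrder = IsTotalOrder.isPartialOrder isTotalOrder }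

  open PosetReasoning poset

  +-monoʳ-≤ : ∀ {x y} z → x ≤ y → z + x ≤ z + y
  +-monoʳ-≤ {x} {y} z x≤y = begin
    z + x  ≈⟨ +-comm z x ⟩
    x + z  ≤⟨ +-mono-≤ z x≤y ⟩
    y + z  ≈⟨ +-comm y z ⟩
    z + y  ∎

  +-mono-≤₂ : ∀ {x y u v} → x ≤ y → u ≤ v → x + u ≤ y + v
  +-mono-≤₂ {x} {y} {u} {v} x≤y u≤v = begin
    x + u  ≤⟨ +-mono-≤ u x≤y ⟩
    y + u  ≤⟨ +-monoʳ-≤ y u≤v ⟩
    y + v  ∎

  x≤y⇒0≤y-x : ∀ {x y} → x ≤ y → 0# ≤ y + - x
  x≤y⇒0≤y-x {x} {y} x≤y = begin
    0#      ≈⟨ -‿inverseʳ x ⟨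
    x + - x ≤⟨ +-mono-≤ (- x) x≤y ⟩
    y + - x ∎

  -x*-x≈x*x : ∀ x → - x * - x ≈ x * x
  -x*-x≈x*x x = begin-equality
    - x * - x     ≈⟨ -‿distribˡ-* x (- x) ⟨
    - (x * - x)   ≈⟨ -‿cong (-‿distribʳ-* x x) ⟨
    - (- (x * x)) ≈⟨ -‿involutive (x * x) ⟩
    x * x         ∎

  0≤x*x : ∀ x → 0# ≤ x * x
  0≤x*x x with total 0# x
  ... | inj₁ 0≤x = *-nonneg 0≤x 0≤x
  ... | inj₂ x≤0 = ≤-trans (*-nonneg 0≤-x 0≤-x) (≤-reflexive (-x*-x≈x*x x))
    where
    0≤-x : 0# ≤ - x
    0≤-x = ≤-trans (x≤y⇒0≤y-x x≤0) (≤-reflexive (+-identityˡ (- x)))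

  0≤1 : 0# ≤ 1#
  0≤1 = ≤-trans (0≤x*x 1#) (≤-reflexive (*-identityˡ 1#))

  *-monoˡ-≤-nonNeg : ∀ {x y z} → 0# ≤ z → x ≤ y → z * x ≤ z * y
  *-monoˡ-≤-nonNeg {x} {y} {z} 0≤z x≤y = begin
    z * x                  ≈⟨ +-identityʳ (z * x) ⟨
    z * x + 0#             ≤⟨ +-monoʳ-≤ (z * x) (*-nonneg 0≤z (x≤y⇒0≤y-x x≤y)) ⟩
    z * x + z * (y + - x)  ≈⟨ solve 4 (λ z x y -x → z :* x :+ z :* (y :+ -x) := z :* (y :+ (x :+ -x)))
                                refl z x y (- x) ⟩
    z * (y + (x + - x))    ≈⟨ *-congˡ (trans (+-congˡ (-‿inverseʳ x)) (+-identityʳ y)) ⟩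
    z * y                  ∎

  x*y+x*y≤x*x+y*y : ∀ x y → x * y + x * y ≤ x * x + y * y
  x*y+x*y≤x*x+y*y x y = begin
    x * y + x * y                                       ≈⟨ +-identityˡ _ ⟨
    0# + (x * y + x * y)                                ≤⟨ +-mono-≤ _ (0≤x*x (x + - y)) ⟩
    (x + - y) * (x + - y) + (x * y + x * y)
      ≈⟨ solve 3 (λ x y -y → (x :+ -y) :* (x :+ -y) :+ (x :* y :+ x :* y)
                   := x :* x :+ -y :* -y :+ (x :* (-y :+ y) :+ x :* (-y :+ y)))
           refl x y (- y) ⟩
    x * x + - y * - y + (x * (- y + y) + x * (- y + y))  ≈⟨ +-cong (+-congˡ (-x*-x≈x*x y)) (+-cong x[-y+y]≈0 x[-y+y]≈0) ⟩
    x * x + y * y + (0# + 0#)                            ≈⟨ trans (+-congˡ (+-identityˡ 0#)) (+-identityʳ _) ⟩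
    x * x + y * y                                        ∎
    where
    x[-y+y]≈0 : x * (- y + y) ≈ 0#
    x[-y+y]≈0 = trans (*-congˡ (-‿inverseˡ y)) (zeroʳ x)

  x+x≤y+y⇒x≤y : ∀ {x y} → x + x ≤ y + y → x ≤ y
  x+x≤y+y⇒x≤y {x} {y} x+x≤y+y with total x y
  ... | inj₁ x≤y = x≤y
  ... | inj₂ y≤x = ≤-reflexive (+-cancelʳ y x y (antisym x+y≤y+y y+y≤x+y))
    where
    x+y≤y+y : x + y ≤ y + y
    x+y≤y+y = ≤-trans (+-monoʳ-≤ x y≤x) x+x≤y+y
    y+y≤x+y : y + y ≤ x + y
    y+y≤x+y = +-mono-≤ y y≤x

module FiniteSums {c ℓ : Level} (F : OrderedField c ℓ) where
  open OrderedField F hiding (_≤_)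
  open CommutativeRing commutativeRing using (refl; *-identityˡ; semiring)
  open OrderedFieldProperties F
  open SemiringSum semiring public
    using (sum; sum-cong-≋; sum-cong-≗; ∑-distrib-+; ∑-comm; *-distribˡ-sum; sum-replicate)
  open SemiringMult semiring using (_×_; ×-congʳ; ×-assoc-*)
  open PosetReasoning poset

  ∑≡sum : ∀ {n} (f : Fin n → Carrier) → ∑ f ≡ sum f
  ∑≡sum {zero}  f = ≡.refl
  ∑≡sum {suc n} f = cong (f zero +_) (∑≡sum (λ i → f (suc i)))

  fromℕ≡×1# : ∀ n → fromℕ n ≡ n × 1#
  fromℕ≡×1# zero    = ≡.refl
  fromℕ≡×1# (suc n) = cong (1# +_) (fromℕ≡×1# n)

  sum-mono-≤ : ∀ {n} {f g : Fin n → Carrier} → (∀ i → f i ≤ g i) → sum f ≤ sum g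
  sum-mono-≤ {zero}  f≤g = ≤-reflexive refl
  sum-mono-≤ {suc n} f≤g = +-mono-≤₂ (f≤g zero) (sum-mono-≤ (λ i → f≤g (suc i)))

  argmax : ∀ {n} (f : Fin (suc n) → Carrier) → Σ (Fin (suc n)) (λ u → ∀ w → f w ≤ f u)
  argmax {zero}  f = zero , λ { zero → ≤-reflexive refl }
  argmax {suc n} f with argmax (λ i → f (suc i))
  ... | u , f∘suc≤fu with total (f zero) (f (suc u))
  ...   | inj₁ f0≤fu = suc u , λ { zero → f0≤fu ; (suc w) → f∘suc≤fu w }
  ...   | inj₂ fu≤f0 = zero  , λ { zero → ≤-reflexive refl ; (suc w) → ≤-trans (f∘suc≤fu w) fu≤f0 }

  sum≤n*max : ∀ {n} (f : Fin (suc n) → Carrier) → Σ (Fin (suc n)) (λ u → sum f ≤ fromℕ (suc n) * f u)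
  sum≤n*max {n} f with argmax f
  ... | u , f≤fu = u , (begin
    sum f                      ≤⟨ sum-mono-≤ f≤fu ⟩
    sum {suc n} (λ _ → f u)    ≈⟨ sum-replicate (suc n) {f u} ⟩
    suc n × f u                ≈⟨ ×-congʳ (suc n) (*-identityˡ (f u)) ⟨
    suc n × (1# * f u)         ≈⟨ ×-assoc-* (suc n) 1# (f u) ⟨
    (suc n × 1#) * f u         ≡⟨ cong (_* f u) (fromℕ≡×1# (suc n)) ⟨
    fromℕ (suc n) * f u        ∎)

module QuadraticForms {c ℓ : Level} (F : OrderedField c ℓ) where
  open OrderedField F hiding (_≤_)
  open CommutativeRing commutativeRing using (refl; trans; +-congʳ; *-congʳ; distribˡ; commutativeSemiring)
  open OrderedFieldProperties F
  open FiniteSums F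
  open NaturalSolver commutativeSemiring using (solve; _:*_; _:=_)
  open PosetReasoning poset

  quadraticForm : ∀ {n} → (Fin n → Fin n → Carrier) → (Fin n → Carrier) → Carrier
  quadraticForm M x = sum (λ u → sum (λ v → M u v * (x u * x v)))

  quadraticForm≈∑x*Mx : ∀ {n} (M : Fin n → Fin n → Carrier) (x : Fin n → Carrier) →
                        quadraticForm M x ≈ sum (λ u → x u * sum (λ v → M u v * x v))
  quadraticForm≈∑x*Mx M x = sum-cong-≋ λ u → begin-equality
    sum (λ v → M u v * (x u * x v))  ≈⟨ sum-cong-≋ (λ v → solve 3 (λ m y z → m :* (y :* z) := y :* (m :* z))
                                                              refl (M u v) (x u) (x v)) ⟩
    sum (λ v → x u * (M u v * x v))  ≈⟨ *-distribˡ-sum (x u) (λ v → M u v * x v) ⟨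
    x u * sum (λ v → M u v * x v)    ∎

  module _ {n} (M : Fin n → Fin n → Carrier) (M-sym : ∀ u v → M u v ≈ M v u)
           (M-nonNeg : ∀ u v → 0# ≤ M u v) (x : Fin n → Carrier) where

    quadraticForm≤∑∑M*x² : quadraticForm M x ≤ sum (λ u → sum (λ v → M u v * (x v * x v)))
    quadraticForm≤∑∑M*x² = x+x≤y+y⇒x≤y (begin
      sum (λ u → sum (p u)) + sum (λ u → sum (p u))      ≈⟨ ∑-distrib-+ (λ u → sum (p u)) (λ u → sum (p u)) ⟨
      sum (λ u → sum (p u) + sum (p u))                  ≈⟨ sum-cong-≋ (λ u → ∑-distrib-+ (p u) (p u)) ⟨
      sum (λ u → sum (λ v → p u v + p u v))              ≤⟨ sum-mono-≤ (λ u → sum-mono-≤ (λ v → amgm u v)) ⟩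
      sum (λ u → sum (λ v → s′ u v + s u v))             ≈⟨ sum-cong-≋ (λ u → ∑-distrib-+ (s′ u) (s u)) ⟩
      sum (λ u → sum (s′ u) + sum (s u))                 ≈⟨ ∑-distrib-+ (λ u → sum (s′ u)) (λ u → sum (s u)) ⟩
      sum (λ u → sum (s′ u)) + sum (λ u → sum (s u))     ≈⟨ +-congʳ ∑s′≈∑s ⟩
      sum (λ u → sum (s u)) + sum (λ u → sum (s u))      ∎)
      where
      p s s′ : Fin n → Fin n → Carrier
      p  u v = M u v * (x u * x v)
      s  u v = M u v * (x v * x v)
      s′ u v = M u v * (x u * x u)

      amgm : ∀ u v → p u v + p u v ≤ s′ u v + s u v
      amgm u v = begin
        M u v * (x u * x v) + M u v * (x u * x v)  ≈⟨ distribˡ (M u v) _ _ ⟨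
        M u v * (x u * x v + x u * x v)            ≤⟨ *-monoˡ-≤-nonNeg (M-nonNeg u v) (x*y+x*y≤x*x+y*y (x u) (x v)) ⟩
        M u v * (x u * x u + x v * x v)            ≈⟨ distribˡ (M u v) _ _ ⟩
        M u v * (x u * x u) + M u v * (x v * x v)  ∎

      ∑s′≈∑s : sum (λ u → sum (s′ u)) ≈ sum (λ u → sum (s u))
      ∑s′≈∑s = trans (∑-comm s′) (sum-cong-≋ λ v → sum-cong-≋ λ u → *-congʳ (M-sym u v))

module AdjacencyProperties {c ℓ : Level} (F : OrderedField c ℓ) {n : ℕ} (G : Graph n) where
  open OrderedField F hiding (_≤_)
  open CommutativeRing commutativeRing using (refl; *-congˡ; *-identityˡ; zeroˡ; commutativeSemiring)
  open OrderedFieldProperties F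
  open FiniteSums F
  open QuadraticForms F
  open NaturalSolver commutativeSemiring using (solve; _:*_; _:=_)
  open PosetReasoning poset
  open Graph G

  A-sym : ∀ u v → A F G u v ≈ A F G v u
  A-sym u v rewrite adj-sym u v = refl

  0≤A : ∀ u v → 0# ≤ A F G u v
  0≤A u v with adj u v
  ... | true  = 0≤1
  ... | false = ≤-reflexive refl

  A*y≈if-adj : ∀ u v y → A F G u v * y ≈ (if adj u v then y else 0#)
  A*y≈if-adj u v y with adj u v
  ... | true  = *-identityˡ y
  ... | false = zeroˡ y

  ∑nbrSqSum≈∑∑A*x² : ∀ x → sum (nbrSqSum F G x) ≈ sum (λ u → sum (λ v → A F G u v * (x v * x v)))
  ∑nbrSqSum≈∑∑A*x² x = sum-cong-≋ λ u → begin-equality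
    nbrSqSum F G x u                                    ≡⟨ ∑≡sum (λ v → if adj u v then x v * x v else 0#) ⟩
    sum (λ v → if adj u v then x v * x v else 0#)       ≈⟨ sum-cong-≋ (λ v → A*y≈if-adj u v (x v * x v)) ⟨
    sum (λ v → A F G u v * (x v * x v))                 ∎

  eigenvector⇒quadraticForm≈μ*normSq : ∀ μ x → (∀ u → Amul F G x u ≈ μ * x u) →
                                       quadraticForm (A F G) x ≈ μ * normSq F G x
  eigenvector⇒quadraticForm≈μ*normSq μ x Ax≈μx = begin-equality
    quadraticForm (A F G) x                           ≈⟨ quadraticForm≈∑x*Mx (A F G) x ⟩
    sum (λ u → x u * sum (λ v → A F G u v * x v))     ≡⟨ sum-cong-≗ (λ u → cong (x u *_) (∑≡sum (λ v → A F G u v * x v))) ⟨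
    sum (λ u → x u * Amul F G x u)                    ≈⟨ sum-cong-≋ (λ u → *-congˡ (Ax≈μx u)) ⟩
    sum (λ u → x u * (μ * x u))                       ≈⟨ sum-cong-≋ (λ u → solve 2 (λ y m → y :* (m :* y) := m :* (y :* y)) refl (x u) μ) ⟩
    sum (λ u → μ * (x u * x u))                       ≈⟨ *-distribˡ-sum μ (λ u → x u * x u) ⟨
    μ * sum (λ u → x u * x u)                         ≡⟨ cong (μ *_) (∑≡sum (λ u → x u * x u)) ⟨
    μ * normSq F G x                                  ∎

lemma3p3 : ∀ {c ℓ : Level} (F : OrderedField c ℓ) (n : ℕ) (G : Graph n) →
    Connected G →
    (λ₁ : OrderedField.Carrier F) → IsLargestEigenvalue F G λ₁ →
    (ν : Fin n → OrderedField.Carrier F) → IsPerronEigenvector F G λ₁ ν →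
    OrderedField._≈_ F (normSq F G ν) (OrderedField.1# F) →
    Σ (Fin n) (λ u → OrderedField._≤_ F λ₁ (OrderedField._*_ F (OrderedField.fromℕ F n) (nbrSqSum F G ν u)))
lemma3p3 F zero    G _ λ₁ _ ν _ ‖ν‖²≈1 = ⊥-elim (OrderedField.0≉1 F ‖ν‖²≈1)
lemma3p3 F (suc m) G _ λ₁ _ ν ((_ , Aν≈λ₁ν) , _) ‖ν‖²≈1 =
  let u , ∑nbrSqSum≤n*nbrSqSumᵤ = sum≤n*max (nbrSqSum F G ν) in
  u , (begin
    λ₁                                               ≈⟨ *-identityʳ λ₁ ⟨
    λ₁ * 1#                                          ≈⟨ *-congˡ ‖ν‖²≈1 ⟨
    λ₁ * normSq F G ν                                ≈⟨ eigenvector⇒quadraticForm≈μ*normSq λ₁ ν Aν≈λ₁ν ⟨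
    quadraticForm (A F G) ν                          ≤⟨ quadraticForm≤∑∑M*x² (A F G) A-sym 0≤A ν ⟩
    sum (λ w → sum (λ v → A F G w v * (ν v * ν v)))  ≈⟨ ∑nbrSqSum≈∑∑A*x² ν ⟨
    sum (nbrSqSum F G ν)                             ≤⟨ ∑nbrSqSum≤n*nbrSqSumᵤ ⟩
    fromℕ (suc m) * nbrSqSum F G ν u                 ∎)
  where
  open OrderedField F using (_*_; 1#; fromℕ)
  open CommutativeRing (OrderedField.commutativeRing F) using (*-congˡ; *-identityʳ)
  open OrderedFieldProperties F
  open FiniteSums F
  open QuadraticForms F
  open AdjacencyProperties F G
  open PosetReasoning poset
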